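{- Let $k \ge 1$ and let $n \in I_k$. Then $\deg(B_{2^k-n})=\deg(B_n)$.
   Context: The Stern polynomials $B_n(t)\in\mathbb{Z}[t]$ are defined by $B_0=0$, $B_1=1$, $B_{2n}=tB_n$, $B_{2n+1}=B_n+B_{n+1}$. A BSD representation of an integer is a digit string $(b_{m-1}\cdots b_0)$ with $b_j\in\{1,0,-1\}$ representing $\sum b_j2^j$. A non-adjacent form (NAF) is a BSD representation in which no two adjacent digits are both nonzero; it is reduced if its leading digit is nonzero. Every positive integer has exactly one reduced NAF; its length is the NAF-bitlength. $I_k$ denotes the set of positive integers of NAF-bitlength $k$. -}

module Defs where

open import Data.Nat using (ℕ; zero; suc)
open import Data.Nat.Binary.Base using (ℕᵇ; 2[1+_]; 1+[2_]) renaming (zero to zeroᵇ; fromℕ' to toBin)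
open import Data.Integer using (ℤ; +_; _+_; -[1+_])
open import Data.List using (List; []; _∷_; length)
open import Data.Maybe using (Maybe; just; nothing)
open import Data.Product using (_×_; _,_; proj₁; Σ; ∃)
open import Relation.Binary.PropositionalEquality using (_≡_; _≢_)
open import Data.Unit using (⊤)
open import Data.Empty using (⊥)

-- Polynomials in ℤ[t] as coefficient lists, constant term first.
-- Trailing zero coefficients are allowed; the degree ignores them.

Poly : Set
Poly = List ℤ

_⊕_ : Poly → Poly → Poly
[]       ⊕ q        = q
(a ∷ p)  ⊕ []       = a ∷ p
(a ∷ p)  ⊕ (b ∷ q)  = (a + b) ∷ (p ⊕ q)

t·_ : Poly → Poly
t· p = + 0 ∷ p

deg : Poly → Maybe ℕ
deg []        = nothing
deg (a ∷ p) with deg p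
... | just d  = just (suc d)
... | nothing with a
...   | + zero = nothing
...   | _      = just 0

-- Stern polynomials:  B 0 = 0, B 1 = 1, B (2n) = t B n, B (2n+1) = B n + B (n+1).
-- Computed structurally on binary naturals via the triple
--   stern3 m = (B m , B (m+1) , B (m+2)).
--   m = 2j+1 : (B j + B (j+1) , t B (j+1) , B (j+1) + B (j+2))
--   m = 2j+2 : (t B (j+1) , B (j+1) + B (j+2) , t B (j+2))

stern3 : ℕᵇ → Poly × Poly × Poly
stern3 zeroᵇ = [] , (+ 1 ∷ []) , (+ 0 ∷ + 1 ∷ [])
stern3 1+[2 j ] with stern3 j
... | a , b , c = (a ⊕ b) , t· b , (b ⊕ c)
stern3 2[1+ j ] with stern3 j
... | a , b , c = t· b , (b ⊕ c) , t· c

B : ℕ → Poly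
B n = proj₁ (stern3 (toBin n))

-- Binary signed digits and non-adjacent forms.
-- A digit string (b_{m-1} ... b_0) is represented as a list
-- b_0 ∷ b_1 ∷ ... ∷ b_{m-1} ∷ [] (least significant digit first).

data Digit : Set where
  d1 d0 dm1 : Digit

digitVal : Digit → ℤ
digitVal d1  = + 1
digitVal d0  = + 0
digitVal dm1 = -[1+ 0 ]

value : List Digit → ℤ
value []       = + 0
value (b ∷ bs) = digitVal b + (value bs + value bs)

NonZeroDigit : Digit → Set
NonZeroDigit d0 = ⊥
NonZeroDigit _  = ⊤

NonAdjacent : List Digit → Set
NonAdjacent []             = ⊤
NonAdjacent (b ∷ [])       = ⊤
NonAdjacent (b ∷ c ∷ bs)   = (NonZeroDigit b → NonZeroDigit c → ⊥) × NonAdjacent (c ∷ bs)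

LeadingNonZero : List Digit → Set
LeadingNonZero []           = ⊥
LeadingNonZero (b ∷ [])     = NonZeroDigit b
LeadingNonZero (b ∷ c ∷ bs) = LeadingNonZero (c ∷ bs)

record ReducedNAF (bs : List Digit) : Set where
  field
    nonAdjacent : NonAdjacent bs
    leading     : LeadingNonZero bs

_∈I_ : ℕ → ℕ → Set
n ∈I k = (1 Data.Nat.≤ n) × ∃ λ (bs : List Digit) →
           ReducedNAF bs × length bs ≡ k × value bs ≡ + n

{-# OPTIONS --safe #-}
module Submission where

-- For n ≥ 1 the degree of B n is the number of zero digits in the reduced NAF
-- of n: a lowest digit 0 doubles the argument and raises the degree by one,
-- while lowest digits 1, 0 or -1, 0 send m to 4m + 1 or 4m - 1, whose degree
-- is again one more because degrees of consecutive Stern polynomials differ by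
-- at most one. If the NAF of n has length k (so its leading digit is 1),
-- negating every digit but the leading one gives a reduced NAF of 2^k - n with
-- the same zero digits.

open import Defs
open import Data.Nat using (ℕ; zero; suc; _+_; _≤_; _^_; _∸_; _⊔_; z≤n; s≤s)
import Data.Nat.Properties as ℕ
open import Data.Nat.Binary.Base as ℕᵇ using (ℕᵇ; 1+[2_]; 2[1+_]; fromℕ') renaming (zero to zeroᵇ)
open import Data.Integer as ℤ using (ℤ; +_; -[1+_]; +≤+; -≤+)
import Data.Integer.Properties as ℤ
open import Data.Integer.Solver using (module +-*-Solver)
open import Data.List using (List; []; _∷_; length)
open import Data.List.Relation.Unary.All using (All; []; _∷_)
open import Data.Maybe as Maybe using (Maybe; just; nothing)
open import Data.Maybe.Relation.Unary.All as MaybeAll using (just; nothing)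
open import Data.Product using (∃; ∃₂; _×_; _,_; proj₁; proj₂)
open import Data.Sum using (_⊎_; inj₁; inj₂)
open import Data.Unit using (tt)
open import Data.Empty using (⊥-elim)
open import Relation.Binary.PropositionalEquality

stern₀ stern₁ stern₂ : ℕᵇ → Poly
stern₀ x = proj₁ (stern3 x)
stern₁ x = proj₁ (proj₂ (stern3 x))
stern₂ x = proj₂ (proj₂ (stern3 x))

stern3-suc : ∀ x → stern₀ (ℕᵇ.suc x) ≡ stern₁ x × stern₁ (ℕᵇ.suc x) ≡ stern₂ x
stern3-suc zeroᵇ    = refl , refl
stern3-suc 1+[2 x ] = refl , refl
stern3-suc 2[1+ x ] with stern3-suc x
... | e₁ , e₂ = cong₂ _⊕_ e₁ e₂ , cong t·_ e₂

B-suc : ∀ m → B (suc m) ≡ stern₁ (fromℕ' m)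
B-suc m = proj₁ (stern3-suc (fromℕ' m))

B-suc-suc : ∀ m → B (suc (suc m)) ≡ stern₂ (fromℕ' m)
B-suc-suc m = trans (B-suc (suc m)) (proj₂ (stern3-suc (fromℕ' m)))

fromℕ'-odd : ∀ m → fromℕ' (suc (m + m)) ≡ 1+[2 fromℕ' m ]
fromℕ'-odd zero = refl
fromℕ'-odd (suc m) rewrite ℕ.+-suc m m | fromℕ'-odd m = refl

B-odd : ∀ m → B (suc (m + m)) ≡ B m ⊕ B (suc m)
B-odd m rewrite fromℕ'-odd m = cong (B m ⊕_) (sym (B-suc m))

B-even : ∀ m → B (suc (suc (m + m))) ≡ t· B (suc m)
B-even m rewrite fromℕ'-odd m = cong t·_ (sym (B-suc m))

NonNegativeCoeffs : Poly → Set
NonNegativeCoeffs = All (+ 0 ℤ.≤_)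

⊕-nonNegative : ∀ {p q} → NonNegativeCoeffs p → NonNegativeCoeffs q → NonNegativeCoeffs (p ⊕ q)
⊕-nonNegative []                 q≥0                = q≥0
⊕-nonNegative (a≥0 ∷ p≥0)        []                 = a≥0 ∷ p≥0
⊕-nonNegative (+≤+ z≤n ∷ p≥0) (+≤+ z≤n ∷ q≥0) = +≤+ z≤n ∷ ⊕-nonNegative p≥0 q≥0

stern3-nonNegative : ∀ x → NonNegativeCoeffs (stern₀ x) × NonNegativeCoeffs (stern₁ x) × NonNegativeCoeffs (stern₂ x)
stern3-nonNegative zeroᵇ = [] , (+≤+ z≤n ∷ []) , (+≤+ z≤n ∷ +≤+ z≤n ∷ [])
stern3-nonNegative 1+[2 x ] with stern3-nonNegative x
... | a , b , c = ⊕-nonNegative a b , +≤+ z≤n ∷ b , ⊕-nonNegative b c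
stern3-nonNegative 2[1+ x ] with stern3-nonNegative x
... | a , b , c = +≤+ z≤n ∷ b , ⊕-nonNegative b c , +≤+ z≤n ∷ c

B-nonNegative : ∀ m → NonNegativeCoeffs (B m)
B-nonNegative m = proj₁ (stern3-nonNegative (fromℕ' m))

_⊔?_ : Maybe ℕ → Maybe ℕ → Maybe ℕ
nothing ⊔? y       = y
just a  ⊔? nothing = just a
just a  ⊔? just b  = just (a ⊔ b)

⊔?-lub : ∀ {n x y} → MaybeAll.All (_≤ n) x → MaybeAll.All (_≤ n) y → MaybeAll.All (_≤ n) (x ⊔? y)
⊔?-lub nothing       y≤n                 = y≤n
⊔?-lub (just a≤n) nothing       = just a≤n
⊔?-lub (just a≤n) (just b≤n) = just (ℕ.⊔-lub a≤n b≤n)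

⊔?-absorbˡ : ∀ {n x} → MaybeAll.All (_≤ n) x → just n ⊔? x ≡ just n
⊔?-absorbˡ nothing      = refl
⊔?-absorbˡ (just a≤n) = cong just (ℕ.m≥n⇒m⊔n≡m a≤n)

⊔?-absorbʳ : ∀ {n x} → MaybeAll.All (_≤ n) x → x ⊔? just n ≡ just n
⊔?-absorbʳ nothing      = refl
⊔?-absorbʳ (just a≤n) = cong just (ℕ.m≤n⇒m⊔n≡n a≤n)

deg-t· : ∀ p → deg (t· p) ≡ Maybe.map suc (deg p)
deg-t· p with deg p
... | just d  = refl
... | nothing = refl

cons-deg : ℤ → Maybe ℕ → Maybe ℕ
cons-deg a        (just d) = just (suc d)
cons-deg (+ zero) nothing  = nothing
cons-deg _        nothing  = just 0

deg-∷ : ∀ a p → deg (a ∷ p) ≡ cons-deg a (deg p)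
deg-∷ a p with deg p
... | just d  = refl
... | nothing with a
...   | + zero   = refl
...   | + suc _  = refl
...   | -[1+ _ ] = refl

cons-deg-+-⊔? : ∀ a b x y → cons-deg (+ (a + b)) (x ⊔? y) ≡ cons-deg (+ a) x ⊔? cons-deg (+ b) y
cons-deg-+-⊔? a       b       (just _) (just _) = refl
cons-deg-+-⊔? a       zero    (just _) nothing  = refl
cons-deg-+-⊔? a       (suc b) (just _) nothing  = refl
cons-deg-+-⊔? zero    b       nothing  (just _) = refl
cons-deg-+-⊔? (suc a) b       nothing  (just _) = refl
cons-deg-+-⊔? zero    zero    nothing  nothing  = refl
cons-deg-+-⊔? zero    (suc b) nothing  nothing  = refl
cons-deg-+-⊔? (suc a) zero    nothing  nothing  = refl
cons-deg-+-⊔? (suc a) (suc b) nothing  nothing  = refl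

-- Without nonnegativity the leading coefficients could cancel.
deg-⊕ : ∀ {p q} → NonNegativeCoeffs p → NonNegativeCoeffs q → deg (p ⊕ q) ≡ deg p ⊔? deg q
deg-⊕ {[]}        _ _ = refl
deg-⊕ {a ∷ p} {[]} _ _ with deg (a ∷ p)
... | just _  = refl
... | nothing = refl
deg-⊕ {+ a ∷ p} {+ b ∷ q} (_ ∷ p≥0) (_ ∷ q≥0) = begin
  deg (+ (a + b) ∷ (p ⊕ q))                     ≡⟨ deg-∷ (+ (a + b)) (p ⊕ q) ⟩
  cons-deg (+ (a + b)) (deg (p ⊕ q))            ≡⟨ cong (cons-deg (+ (a + b))) (deg-⊕ p≥0 q≥0) ⟩
  cons-deg (+ (a + b)) (deg p ⊔? deg q)         ≡⟨ cons-deg-+-⊔? a b (deg p) (deg q) ⟩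
  cons-deg (+ a) (deg p) ⊔? cons-deg (+ b) (deg q) ≡⟨ cong₂ _⊔?_ (deg-∷ (+ a) p) (deg-∷ (+ b) q) ⟨
  deg (+ a ∷ p) ⊔? deg (+ b ∷ q)                ∎
  where open ≡-Reasoning

deg-B-double : ∀ m → deg (B (m + m)) ≡ Maybe.map suc (deg (B m))
deg-B-double zero = refl
deg-B-double (suc m) rewrite ℕ.+-suc m m | B-even m = deg-t· (B (suc m))

deg-B-even : ∀ m → deg (B (suc (suc (m + m)))) ≡ Maybe.map suc (deg (B (suc m)))
deg-B-even m = trans (cong deg (B-even m)) (deg-t· (B (suc m)))

deg-B-odd : ∀ m → deg (B (suc (m + m))) ≡ deg (B m) ⊔? deg (B (suc m))
deg-B-odd m rewrite B-odd m = deg-⊕ (B-nonNegative m) (B-nonNegative (suc m))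

CloseDegrees : Poly → Poly → Set
CloseDegrees p q = ∃₂ λ β γ → deg p ≡ just β × deg q ≡ just γ × β ≤ suc γ × γ ≤ suc β

stern3-closeDegrees : ∀ x → CloseDegrees (stern₁ x) (stern₂ x)
stern3-closeDegrees zeroᵇ = 0 , 1 , refl , refl , z≤n , s≤s z≤n
stern3-closeDegrees 1+[2 x ] with stern3-closeDegrees x | stern3-nonNegative x
... | β , γ , eβ , eγ , β≤ , γ≤ | _ , q≥0 , r≥0 =
  suc β , β ⊔ γ ,
  trans (deg-t· (stern₁ x)) (cong (Maybe.map suc) eβ) ,
  trans (deg-⊕ q≥0 r≥0) (cong₂ _⊔?_ eβ eγ) ,
  s≤s (ℕ.m≤m⊔n β γ) , ℕ.⊔-lub (ℕ.m≤n⇒m≤1+n (ℕ.n≤1+n β)) (ℕ.m≤n⇒m≤1+n γ≤)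
stern3-closeDegrees 2[1+ x ] with stern3-closeDegrees x | stern3-nonNegative x
... | β , γ , eβ , eγ , β≤ , γ≤ | _ , q≥0 , r≥0 =
  β ⊔ γ , suc γ ,
  trans (deg-⊕ q≥0 r≥0) (cong₂ _⊔?_ eβ eγ) ,
  trans (deg-t· (stern₂ x)) (cong (Maybe.map suc) eγ) ,
  ℕ.⊔-lub (ℕ.m≤n⇒m≤1+n β≤) (ℕ.m≤n⇒m≤1+n (ℕ.n≤1+n γ)) , s≤s (ℕ.m≤n⊔m β γ)

B-closeDegrees : ∀ m → CloseDegrees (B (suc m)) (B (suc (suc m)))
B-closeDegrees m with stern3-closeDegrees (fromℕ' m)
... | β , γ , eβ , eγ , close =
  β , γ , trans (cong deg (B-suc m)) eβ , trans (cong deg (B-suc-suc m)) eγ , close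

deg-B-suc-≤ : ∀ m {z} → deg (B m) ≡ just z → MaybeAll.All (_≤ suc z) (deg (B (suc m)))
deg-B-suc-≤ (suc m) e with B-closeDegrees m
... | β , γ , eβ , eγ , _ , γ≤ with trans (sym eβ) e
... | refl rewrite eγ = just γ≤

deg-B-pred-≤ : ∀ m {z} → deg (B (suc m)) ≡ just z → MaybeAll.All (_≤ suc z) (deg (B m))
deg-B-pred-≤ zero    _ = nothing
deg-B-pred-≤ (suc m) e with B-closeDegrees m
... | β , γ , eβ , eγ , β≤ , _ with trans (sym eγ) e
... | refl rewrite eβ = just β≤

deg-B-4m+1 : ∀ m {z} → deg (B m) ≡ just z → deg (B (suc ((m + m) + (m + m)))) ≡ just (suc z)
deg-B-4m+1 m {z} e = begin
  deg (B (suc ((m + m) + (m + m))))                   ≡⟨ deg-B-odd (m + m) ⟩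
  deg (B (m + m)) ⊔? deg (B (suc (m + m)))            ≡⟨ cong₂ _⊔?_ (trans (deg-B-double m) (cong (Maybe.map suc) e)) (deg-B-odd m) ⟩
  just (suc z) ⊔? (deg (B m) ⊔? deg (B (suc m)))     ≡⟨ ⊔?-absorbˡ (⊔?-lub deg-B-m-≤ (deg-B-suc-≤ m e)) ⟩
  just (suc z)                                        ∎
  where
  open ≡-Reasoning
  deg-B-m-≤ : MaybeAll.All (_≤ suc z) (deg (B m))
  deg-B-m-≤ = subst (MaybeAll.All (_≤ suc z)) (sym e) (just (ℕ.n≤1+n z))

deg-B-4m+3 : ∀ m {z} → deg (B (suc m)) ≡ just z → deg (B (suc (suc (m + m) + suc (m + m)))) ≡ just (suc z)
deg-B-4m+3 m {z} e = begin
  deg (B (suc (suc (m + m) + suc (m + m))))           ≡⟨ deg-B-odd (suc (m + m)) ⟩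
  deg (B (suc (m + m))) ⊔? deg (B (suc (suc (m + m)))) ≡⟨ cong₂ _⊔?_ (deg-B-odd m) (trans (deg-B-even m) (cong (Maybe.map suc) e)) ⟩
  (deg (B m) ⊔? deg (B (suc m))) ⊔? just (suc z)     ≡⟨ ⊔?-absorbʳ (⊔?-lub (deg-B-pred-≤ m e) deg-B-suc-m-≤) ⟩
  just (suc z)                                        ∎
  where
  open ≡-Reasoning
  deg-B-suc-m-≤ : MaybeAll.All (_≤ suc z) (deg (B (suc m)))
  deg-B-suc-m-≤ = subst (MaybeAll.All (_≤ suc z)) (sym e) (just (ℕ.n≤1+n z))

zeroDigit : Digit → ℕ
zeroDigit d0 = 1
zeroDigit _  = 0

zeroDigits : List Digit → ℕ
zeroDigits []       = 0
zeroDigits (b ∷ bs) = zeroDigit b + zeroDigits bs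

value-d0∷ : ∀ cs {n} → value (d0 ∷ cs) ≡ + n → ∃ λ m → value cs ≡ + m × n ≡ m + m
value-d0∷ cs eq with value cs
... | + m = m , refl , sym (ℤ.+-injective eq)

value-d1∷d0∷ : ∀ cs {n} → value (d1 ∷ d0 ∷ cs) ≡ + n →
               ∃ λ m → value cs ≡ + m × n ≡ suc ((m + m) + (m + m))
value-d1∷d0∷ cs eq with value cs
... | + m = m , refl , sym (ℤ.+-injective eq)

value-dm1∷d0∷ : ∀ cs {n} → value (dm1 ∷ d0 ∷ cs) ≡ + n →
                ∃ λ m → value cs ≡ + suc m × n ≡ suc (suc (m + m) + suc (m + m))
value-dm1∷d0∷ cs eq with value cs
... | + suc m = m , refl , trans (sym (ℤ.+-injective eq)) 4m+3
  where
  4m+3 : (m + suc m) + suc (m + suc m) ≡ suc (suc (m + m) + suc (m + m))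
  4m+3 rewrite ℕ.+-suc m m | ℕ.+-suc (suc (m + m)) (suc (m + m)) = refl

DegreeIsZeroCount : List Digit → Set
DegreeIsZeroCount bs = ∀ {n} → value bs ≡ + n → deg (B n) ≡ just (zeroDigits bs)

d0∷-degreeIsZeroCount : ∀ cs → DegreeIsZeroCount cs → DegreeIsZeroCount (d0 ∷ cs)
d0∷-degreeIsZeroCount cs ih eq with value-d0∷ cs eq
... | m , eq′ , refl = trans (deg-B-double m) (cong (Maybe.map suc) (ih eq′))

d1∷d0∷-degreeIsZeroCount : ∀ cs → DegreeIsZeroCount cs → DegreeIsZeroCount (d1 ∷ d0 ∷ cs)
d1∷d0∷-degreeIsZeroCount cs ih eq with value-d1∷d0∷ cs eq
... | m , eq′ , refl = deg-B-4m+1 m (ih eq′)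

dm1∷d0∷-degreeIsZeroCount : ∀ cs → DegreeIsZeroCount cs → DegreeIsZeroCount (dm1 ∷ d0 ∷ cs)
dm1∷d0∷-degreeIsZeroCount cs ih eq with value-dm1∷d0∷ cs eq
... | m , eq′ , refl = deg-B-4m+3 m (ih eq′)

naf-degreeIsZeroCount : ∀ bs → NonAdjacent bs → LeadingNonZero bs → DegreeIsZeroCount bs
naf-degreeIsZeroCount (d1 ∷ []) _ _ eq with ℤ.+-injective eq
... | refl = refl
naf-degreeIsZeroCount (d0 ∷ c ∷ cs) (_ , na) ln =
  d0∷-degreeIsZeroCount (c ∷ cs) (naf-degreeIsZeroCount (c ∷ cs) na ln)
naf-degreeIsZeroCount (d1 ∷ d0 ∷ c ∷ cs) (_ , _ , na) ln =
  d1∷d0∷-degreeIsZeroCount (c ∷ cs) (naf-degreeIsZeroCount (c ∷ cs) na ln)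
naf-degreeIsZeroCount (dm1 ∷ d0 ∷ c ∷ cs) (_ , _ , na) ln =
  dm1∷d0∷-degreeIsZeroCount (c ∷ cs) (naf-degreeIsZeroCount (c ∷ cs) na ln)
naf-degreeIsZeroCount (d1  ∷ d1  ∷ _) (adj , _) _ = ⊥-elim (adj tt tt)
naf-degreeIsZeroCount (d1  ∷ dm1 ∷ _) (adj , _) _ = ⊥-elim (adj tt tt)
naf-degreeIsZeroCount (dm1 ∷ d1  ∷ _) (adj , _) _ = ⊥-elim (adj tt tt)
naf-degreeIsZeroCount (dm1 ∷ dm1 ∷ _) (adj , _) _ = ⊥-elim (adj tt tt)

negateDigit : Digit → Digit
negateDigit d1  = dm1
negateDigit d0  = d0
negateDigit dm1 = d1

negateLower : List Digit → List Digit
negateLower []           = []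
negateLower (b ∷ [])     = b ∷ []
negateLower (b ∷ c ∷ bs) = negateDigit b ∷ negateLower (c ∷ bs)

leadingDigit : List Digit → Digit
leadingDigit []           = d0
leadingDigit (b ∷ [])     = b
leadingDigit (b ∷ c ∷ bs) = leadingDigit (c ∷ bs)

nonZero-negateDigit : ∀ b → NonZeroDigit (negateDigit b) → NonZeroDigit b
nonZero-negateDigit d1  _ = tt
nonZero-negateDigit dm1 _ = tt

negateLower-nonAdjacent : ∀ bs → NonAdjacent bs → NonAdjacent (negateLower bs)
negateLower-nonAdjacent []           _ = tt
negateLower-nonAdjacent (b ∷ [])     _ = tt
negateLower-nonAdjacent (b ∷ c ∷ []) (adj , _) =
  (λ nb → adj (nonZero-negateDigit b nb)) , tt
negateLower-nonAdjacent (b ∷ c ∷ d ∷ ds) (adj , na) =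
  (λ nb nc → adj (nonZero-negateDigit b nb) (nonZero-negateDigit c nc)) ,
  negateLower-nonAdjacent (c ∷ d ∷ ds) na

negateLower-leadingNonZero : ∀ bs → LeadingNonZero bs → LeadingNonZero (negateLower bs)
negateLower-leadingNonZero (b ∷ [])         ln = ln
negateLower-leadingNonZero (b ∷ c ∷ [])     ln = ln
negateLower-leadingNonZero (b ∷ c ∷ d ∷ ds) ln = negateLower-leadingNonZero (c ∷ d ∷ ds) ln

leadingDigit-negateLower : ∀ bs → leadingDigit (negateLower bs) ≡ leadingDigit bs
leadingDigit-negateLower []               = refl
leadingDigit-negateLower (b ∷ [])         = refl
leadingDigit-negateLower (b ∷ c ∷ [])     = refl
leadingDigit-negateLower (b ∷ c ∷ d ∷ ds) = leadingDigit-negateLower (c ∷ d ∷ ds)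

zeroDigit-negateDigit : ∀ b → zeroDigit (negateDigit b) ≡ zeroDigit b
zeroDigit-negateDigit d1  = refl
zeroDigit-negateDigit d0  = refl
zeroDigit-negateDigit dm1 = refl

zeroDigits-negateLower : ∀ bs → zeroDigits (negateLower bs) ≡ zeroDigits bs
zeroDigits-negateLower []           = refl
zeroDigits-negateLower (b ∷ [])     = refl
zeroDigits-negateLower (b ∷ c ∷ bs) =
  cong₂ _+_ (zeroDigit-negateDigit b) (zeroDigits-negateLower (c ∷ bs))

leadingDigit-±1 : ∀ bs → LeadingNonZero bs → leadingDigit bs ≡ d1 ⊎ leadingDigit bs ≡ dm1
leadingDigit-±1 (d1  ∷ [])     _  = inj₁ refl
leadingDigit-±1 (dm1 ∷ [])     _  = inj₂ refl
leadingDigit-±1 (b ∷ c ∷ bs)   ln = leadingDigit-±1 (c ∷ bs) ln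

digitVal-≤1 : ∀ b → digitVal b ℤ.≤ + 1
digitVal-≤1 d1  = ℤ.≤-refl
digitVal-≤1 d0  = +≤+ z≤n
digitVal-≤1 dm1 = -≤+

digitVal-≥-1 : ∀ b → -[1+ 0 ] ℤ.≤ digitVal b
digitVal-≥-1 d1  = -≤+
digitVal-≥-1 d0  = -≤+
digitVal-≥-1 dm1 = ℤ.≤-refl

value-positive : ∀ bs → LeadingNonZero bs → leadingDigit bs ≡ d1 → + 1 ℤ.≤ value bs
value-positive (d1 ∷ [])    _  refl = ℤ.≤-refl
value-positive (b ∷ c ∷ bs) ln e    =
  ℤ.+-mono-≤ (digitVal-≥-1 b) (ℤ.+-mono-≤ (value-positive (c ∷ bs) ln e) (value-positive (c ∷ bs) ln e))

value-negative : ∀ bs → LeadingNonZero bs → leadingDigit bs ≡ dm1 → value bs ℤ.≤ -[1+ 0 ]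
value-negative (dm1 ∷ [])   _  refl = ℤ.≤-refl
value-negative (b ∷ c ∷ bs) ln e    =
  ℤ.+-mono-≤ (digitVal-≤1 b) (ℤ.+-mono-≤ (value-negative (c ∷ bs) ln e) (value-negative (c ∷ bs) ln e))

digitVal-negateDigit : ∀ b → digitVal (negateDigit b) ≡ ℤ.- digitVal b
digitVal-negateDigit d1  = refl
digitVal-negateDigit d0  = refl
digitVal-negateDigit dm1 = refl

value-negateLower-+ : ∀ bs → LeadingNonZero bs → leadingDigit bs ≡ d1 →
                      value (negateLower bs) ℤ.+ value bs ≡ + (2 ^ length bs)
value-negateLower-+ (d1 ∷ [])    _  refl = refl
value-negateLower-+ (b ∷ c ∷ bs) ln e    = begin
  (digitVal (negateDigit b) ℤ.+ (F ℤ.+ F)) ℤ.+ (digitVal b ℤ.+ (V ℤ.+ V))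
    ≡⟨ cong (λ d → (d ℤ.+ (F ℤ.+ F)) ℤ.+ (digitVal b ℤ.+ (V ℤ.+ V))) (digitVal-negateDigit b) ⟩
  (ℤ.- digitVal b ℤ.+ (F ℤ.+ F)) ℤ.+ (digitVal b ℤ.+ (V ℤ.+ V))
    ≡⟨ digits-cancel (digitVal b) F V ⟩
  (F ℤ.+ V) ℤ.+ (F ℤ.+ V)
    ≡⟨ cong (λ x → x ℤ.+ x) (value-negateLower-+ (c ∷ bs) ln e) ⟩
  + (P + P)
    ≡⟨ cong (λ x → + (P + x)) (ℕ.+-identityʳ P) ⟨
  + (2 ^ length (b ∷ c ∷ bs)) ∎
  where
  open ≡-Reasoning
  F = value (negateLower (c ∷ bs))
  V = value (c ∷ bs)
  P = 2 ^ length (c ∷ bs)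
  digits-cancel : ∀ d F V → (ℤ.- d ℤ.+ (F ℤ.+ F)) ℤ.+ (d ℤ.+ (V ℤ.+ V)) ≡ (F ℤ.+ V) ℤ.+ (F ℤ.+ V)
  digits-cancel = solve 3 (λ d F V → (:- d :+ (F :+ F)) :+ (d :+ (V :+ V)) := (F :+ V) :+ (F :+ V)) refl
    where open +-*-Solver

value-negateLower : ∀ bs {n} → LeadingNonZero bs → value bs ≡ + n →
                    value (negateLower bs) ≡ + (2 ^ length bs ∸ n)
value-negateLower bs {n} ln eq with leadingDigit-±1 bs ln
... | inj₂ e with () ← subst (ℤ._≤ -[1+ 0 ]) eq (value-negative bs ln e)
... | inj₁ e
  -- the positivity bound leaves only the case of a nonnegative value
  with value (negateLower bs) | value-negateLower-+ bs ln e
     | value-positive (negateLower bs) (negateLower-leadingNonZero bs ln)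
                      (trans (leadingDigit-negateLower bs) e)
... | + a | sum | _positive rewrite eq =
  cong +_ (trans (sym (ℕ.m+n∸n≡m a n)) (cong (_∸ n) (ℤ.+-injective sum)))

mainTheorem8 : (k n : ℕ) → 1 ≤ k → n ∈I k → deg (B (2 ^ k ∸ n)) ≡ deg (B n)
mainTheorem8 _ n _ (_ , bs , record { nonAdjacent = na ; leading = ln } , refl , eq) = begin
  deg (B (2 ^ length bs ∸ n))         ≡⟨ naf-degreeIsZeroCount (negateLower bs) (negateLower-nonAdjacent bs na)
                                           (negateLower-leadingNonZero bs ln) (value-negateLower bs ln eq) ⟩
  just (zeroDigits (negateLower bs))  ≡⟨ cong just (zeroDigits-negateLower bs) ⟩
  just (zeroDigits bs)                ≡⟨ naf-degreeIsZeroCount bs na ln eq ⟨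
  deg (B n)                           ∎
  where open ≡-Reasoning
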